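{- Let $t\in\mathbb{N}$ and let $\mathcal{F}_1,\dots,\mathcal{F}_k$ be families. If $(\mathcal{F}_1, \dots, \mathcal{F}_k)$ has the strict cross-$t$-star property and there exists a $t$-set $T$ such that $\mathcal{F}_i(T) \in {\rm L}(\mathcal{F}_i,t)$ for each $i \in [k]$, then $(\mathcal{F}_1, \dots, \mathcal{F}_k)$ has the extrastrong cross-$t$-star property.
   Context: All sets and families are finite. Families $\mathcal{A}_1,\dots,\mathcal{A}_k$ are cross-$t$-intersecting if for all distinct $i,j$ each set of $\mathcal{A}_i$ shares at least $t$ elements with each set of $\mathcal{A}_j$; the tuple is below $(\mathcal{F}_1,\dots,\mathcal{F}_k)$ if $\mathcal{A}_i\subseteq\mathcal{F}_i$ for all $i$. $\mathcal{F}(T)=\{F\in\mathcal{F}:T\subseteq F\}$, $l(\mathcal{F},t)=\max_{|T|=t}|\mathcal{F}(T)|$, and ${\rm L}(\mathcal{F},t)$ is the set of $t$-stars $\mathcal{F}(T)$ ($|T|=t$) of size $l(\mathcal{F},t)$. Strict cross-$t$-star property: for every cross-$t$-intersecting tuple below $(\mathcal{F}_1,\dots,\mathcal{F}_k)$, $\prod|\mathcal{A}_i|\leq\prod l(\mathcal{F}_i,t)$, strictly unless there is a $t$-set $T$ with $\mathcal{A}_i=\mathcal{F}_i(T)$ for all $i$. Extrastrong cross-$t$-star property: there is a $t$-set $T$ such that for every cross-$t$-intersecting tuple below it, $\prod|\mathcal{A}_i|\leq\prod|\mathcal{F}_i(T)|$, with equality only if there is a $t$-set $T'$ with $\mathcal{A}_i=\mathcal{F}_i(T')$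 for all $i$. -}

module Defs where

open import Data.Nat using (ℕ; zero; suc; _≤_; _<_; _⊔_)
open import Data.Bool using (Bool; true; false; _∧_; if_then_else_)
open import Data.Fin using (Fin)
open import Data.Fin.Subset using (Subset; _∩_; ∣_∣)
open import Data.Fin.Subset.Properties using (_⊆?_)
open import Data.List using (List; []; _∷_; _++_; map; foldr; allFin)
open import Data.Nat.ListAction using (sum; product)
open import Data.Vec using (_∷_; [])
open import Data.Product using (Σ; _×_; _,_)
open import Relation.Nullary using (¬_)
open import Relation.Nullary.Decidable using (⌊_⌋)
open import Relation.Binary.PropositionalEquality using (_≡_; _≢_)
open import Data.Nat using (_≟_)

-- Ground set: Fin n.  Sets are subsets of Fin n (Subset n = Vec Bool n).
-- A family is a (decidable) predicate on sets, i.e. a set of subsets of Fin n;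
-- it is automatically finite.
Family : ℕ → Set
Family n = Subset n → Bool

allSubsets : (n : ℕ) → List (Subset n)
allSubsets zero    = [] ∷ []
allSubsets (suc n) = map (true ∷_) (allSubsets n) ++ map (false ∷_) (allSubsets n)

_∈ᶠ_ : ∀ {n} → Subset n → Family n → Set
S ∈ᶠ 𝒜 = 𝒜 S ≡ true

size : ∀ {n} → Family n → ℕ
size {n} 𝒜 = sum (map (λ S → if 𝒜 S then 1 else 0) (allSubsets n))

_⊆ᶠ_ : ∀ {n} → Family n → Family n → Set
𝒜 ⊆ᶠ ℱ = ∀ S → S ∈ᶠ 𝒜 → S ∈ᶠ ℱ

_≈ᶠ_ : ∀ {n} → Family n → Family n → Set
𝒜 ≈ᶠ ℬ = ∀ S → 𝒜 S ≡ ℬ S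

star : ∀ {n} → Family n → Subset n → Family n
star ℱ T S = ℱ S ∧ ⌊ T ⊆? S ⌋

tSets : (n t : ℕ) → List (Subset n)
tSets n t = Data.List.filter (λ T → ∣ T ∣ ≟ t) (allSubsets n)
  where import Data.List

l : ∀ {n} → Family n → ℕ → ℕ
l {n} ℱ t = foldr _⊔_ 0 (map (λ T → size (star ℱ T)) (tSets n t))

-- ℱ(T) ∈ L(ℱ,t): T is a t-set and ℱ(T) is a largest t-star
inL : ∀ {n} → Family n → ℕ → Subset n → Set
inL ℱ t T = ∣ T ∣ ≡ t × size (star ℱ T) ≡ l ℱ t

∏ : ∀ {k} → (Fin k → ℕ) → ℕ
∏ {k} f = product (map f (allFin k))

CrossInt : ∀ {n k} → ℕ → (Fin k → Family n) → Set
CrossInt t 𝒜 = ∀ i j → i ≢ j → ∀ A B → A ∈ᶠ 𝒜 i → B ∈ᶠ 𝒜 j → t ≤ ∣ A ∩ B ∣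

Below : ∀ {n k} → (Fin k → Family n) → (Fin k → Family n) → Set
Below 𝒜 ℱ = ∀ i → 𝒜 i ⊆ᶠ ℱ i

IsStarTuple : ∀ {n k} → ℕ → (Fin k → Family n) → (Fin k → Family n) → Set
IsStarTuple {n} t 𝒜 ℱ = Σ (Subset n) λ T → ∣ T ∣ ≡ t × (∀ i → 𝒜 i ≈ᶠ star (ℱ i) T)

StrictCrossStar : ∀ {n k} → ℕ → (Fin k → Family n) → Set
StrictCrossStar {n} {k} t ℱ =
  ∀ (𝒜 : Fin k → Family n) → Below 𝒜 ℱ → CrossInt t 𝒜 →
    (∏ (λ i → size (𝒜 i)) ≤ ∏ (λ i → l (ℱ i) t))
    × (¬ IsStarTuple t 𝒜 ℱ → ∏ (λ i → size (𝒜 i)) < ∏ (λ i → l (ℱ i) t))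

ExtrastrongCrossStar : ∀ {n k} → ℕ → (Fin k → Family n) → Set
ExtrastrongCrossStar {n} {k} t ℱ =
  Σ (Subset n) λ T → ∣ T ∣ ≡ t ×
    (∀ (𝒜 : Fin k → Family n) → Below 𝒜 ℱ → CrossInt t 𝒜 →
      (∏ (λ i → size (𝒜 i)) ≤ ∏ (λ i → size (star (ℱ i) T)))
      × (∏ (λ i → size (𝒜 i)) ≡ ∏ (λ i → size (star (ℱ i) T)) → IsStarTuple t 𝒜 ℱ))

-- Once some t-set T carries a largest t-star in every family, ∏ |ℱᵢ(T)| = ∏ l(ℱᵢ,t),
-- so the strict cross-t-star bound is the extrastrong bound at T, and equality there
-- rules out the strict inequality, leaving a star tuple (the star property is decidable,
-- the ground set being finite). For k = 0 the hypothesis says nothing about |T|; a t-set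
-- is then read off the equality case for the empty tuple.
module Submission where

open import Defs
open import Data.Nat using (ℕ; zero; suc; _≤_; _≟_)
open import Data.Nat.Properties using (<-irrefl)
open import Data.Fin using (Fin)
import Data.Fin as Fin
open import Data.Fin.Subset using (Subset; ∣_∣)
open import Data.Fin.Subset.Properties using (anySubset?)
open import Data.Fin.Properties using (all?)
open import Data.List using (allFin)
open import Data.List.Properties using (map-cong)
open import Data.Nat.ListAction using (product)
open import Data.Product using (Σ; _×_; _,_; proj₁; proj₂)
open import Data.Bool.Properties using () renaming (_≟_ to _≟ᵇ_)
open import Relation.Nullary using (Dec; yes; no)
open import Relation.Nullary.Decidable using (¬?; _×-dec_; decidable-stable)
open import Relation.Binary.PropositionalEquality using (_≡_; refl; cong; subst; sym; trans)

allSubsets? : ∀ {n} {P : Subset n → Set} → (∀ S → Dec (P S)) → Dec (∀ S → P S)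
allSubsets? P? with anySubset? (λ S → ¬? (P? S))
... | yes (S , ¬PS) = no λ ∀P → ¬PS (∀P S)
... | no ¬∃¬P       = yes λ S → decidable-stable (P? S) λ ¬PS → ¬∃¬P (S , ¬PS)

_≈ᶠ?_ : ∀ {n} (𝒜 ℬ : Family n) → Dec (𝒜 ≈ᶠ ℬ)
𝒜 ≈ᶠ? ℬ = allSubsets? λ S → 𝒜 S ≟ᵇ ℬ S

isStarTuple? : ∀ {n k} t (𝒜 ℱ : Fin k → Family n) → Dec (IsStarTuple t 𝒜 ℱ)
isStarTuple? t 𝒜 ℱ =
  anySubset? λ T → (∣ T ∣ ≟ t) ×-dec all? λ i → 𝒜 i ≈ᶠ? star (ℱ i) T

∏-cong : ∀ {k} {f g : Fin k → ℕ} → (∀ i → f i ≡ g i) → ∏ f ≡ ∏ g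
∏-cong {k} f≗g = cong product (map-cong f≗g (allFin k))

∏-largestStars : ∀ {n k} t (ℱ : Fin k → Family n) {T} → (∀ i → inL (ℱ i) t T) →
  ∏ (λ i → size (star (ℱ i) T)) ≡ ∏ (λ i → l (ℱ i) t)
∏-largestStars t ℱ inL-T = ∏-cong λ i → proj₂ (inL-T i)

StrictCrossStar⇒equality-isStarTuple : ∀ {n k} t {ℱ 𝒜 : Fin k → Family n} →
  StrictCrossStar t ℱ → Below 𝒜 ℱ → CrossInt t 𝒜 →
  ∏ (λ i → size (𝒜 i)) ≡ ∏ (λ i → l (ℱ i) t) → IsStarTuple t 𝒜 ℱ
StrictCrossStar⇒equality-isStarTuple t {ℱ} {𝒜} strict below cross ∏≡ =
  decidable-stable (isStarTuple? t 𝒜 ℱ)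
    λ ¬star → <-irrefl ∏≡ (proj₂ (strict 𝒜 below cross) ¬star)

largestStars-tSet : ∀ {n k} t (ℱ : Fin k → Family n) → StrictCrossStar t ℱ →
  Σ (Subset n) (λ T → ∀ i → inL (ℱ i) t T) →
  Σ (Subset n) (λ T → ∣ T ∣ ≡ t × (∀ i → inL (ℱ i) t T))
largestStars-tSet {k = zero} t ℱ strict _
  with T , ∣T∣≡t , _ ← StrictCrossStar⇒equality-isStarTuple t {ℱ} {λ ()} strict (λ ()) (λ ()) refl
  = T , ∣T∣≡t , λ ()
largestStars-tSet {k = suc _} t ℱ strict (T , inL-T) = T , proj₁ (inL-T Fin.zero) , inL-T

proposition2p4 : ∀ {n k : ℕ} (t : ℕ) (ℱ : Fin k → Family n) →
    StrictCrossStar t ℱ →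
    Σ (Subset n) (λ T → ∀ i → inL (ℱ i) t T) →
    ExtrastrongCrossStar t ℱ
proposition2p4 t ℱ strict largest
  with T , ∣T∣≡t , inL-T ← largestStars-tSet t ℱ strict largest
  = T , ∣T∣≡t , λ 𝒜 below cross →
      subst (∏ (λ i → size (𝒜 i)) ≤_) (sym ∏≡) (proj₁ (strict 𝒜 below cross)) ,
      λ ∏𝒜≡ → StrictCrossStar⇒equality-isStarTuple t strict below cross
                (trans ∏𝒜≡ ∏≡)
  where
  ∏≡ : ∏ (λ i → size (star (ℱ i) T)) ≡ ∏ (λ i → l (ℱ i) t)
  ∏≡ = ∏-largestStars t ℱ inL-T
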